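{- For every integer $n \geq 0$, \[ d_n(x) = \sum_{l=0}^n S_1(n,l)\, b_l(x). \] In particular, $d_n = \sum_{l=0}^n S_1(n,l)\, b_l$.
   Context: All generating functions are formal power series in $t$. The type 2 Bernoulli polynomials $b_n(x)$ are defined by $\frac{t}{e^t-e^{ -t}}e^{xt} = \sum_{n\ge0} b_n(x)\frac{t^n}{n!}$, with $b_n=b_n(0)$. The type 2 Daehee polynomials $d_n(x)$ are defined by $\frac{\log(1+t)}{(1+t)-(1+t)^{ -1}}(1+t)^x = \sum_{n\ge0} d_n(x)\frac{t^n}{n!}$, with $d_n = d_n(0)$. The (signed) Stirling numbers of the first kind $S_1(n,l)$ are defined by $\frac{1}{l!}(\log(1+t))^l = \sum_{n\ge l} S_1(n,l)\frac{t^n}{n!}$. -}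

module Defs where

open import Data.Nat as ℕ using (ℕ; zero; suc; _∸_; _≤ᵇ_; _!)
open import Data.Integer using (ℤ; +_; -[1+_])
open import Data.Rational using (ℚ; 0ℚ; 1ℚ; _+_; _*_; -_; _-_; 1/_; _/_; NonZero)
open import Data.Bool using (if_then_else_)

ℕ→ℚ : ℕ → ℚ
ℕ→ℚ n = + n / 1

factℚ : ℕ → ℚ
factℚ n = ℕ→ℚ (n !)

invFact : ℕ → ℚ
invFact zero    = 1ℚ
invFact (suc n) = invFact n * (+ 1 / suc n)

sgn : ℕ → ℚ
sgn zero    = 1ℚ
sgn (suc n) = - sgn n

_^_ : ℚ → ℕ → ℚ
x ^ zero  = 1ℚ
x ^ suc n = x * (x ^ n)

sumTo : ℕ → (ℕ → ℚ) → ℚ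
sumTo zero    f = f 0
sumTo (suc n) f = sumTo n f + f (suc n)

-- Formal power series in t over ℚ, given by their ordinary coefficients:
-- f = Σ_n f n · t^n
PS : Set
PS = ℕ → ℚ

tPS : PS
tPS zero          = 0ℚ
tPS (suc zero)    = 1ℚ
tPS (suc (suc _)) = 0ℚ

onePS : PS
onePS zero    = 1ℚ
onePS (suc _) = 0ℚ

_⊕_ : PS → PS → PS
(f ⊕ g) n = f n + g n

_⊖_ : PS → PS → PS
(f ⊖ g) n = f n - g n

_⊛_ : PS → PS → PS
(f ⊛ g) n = sumTo n (λ k → f k * g (n ∸ k))

psPow : PS → ℕ → PS
psPow f zero    = onePS
psPow f (suc l) = f ⊛ psPow f l

-- Multiplicative inverse of a power series with nonzero constant term:
-- g 0 = 1/f 0,  g n = -(1/f 0) Σ_{j=1}^{n} f j g (n-j)  (n ≥ 1).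
-- invUpTo f m k is correct for k ≤ m (structural recursion on m).
module _ (f : PS) .{{nz : NonZero (f 0)}} where
  private
    c : ℚ
    c = 1/ (f 0)

  invUpTo : ℕ → PS
  invUpTo zero    k = c
  invUpTo (suc m) k =
    if k ≤ᵇ m then invUpTo m k
    else - (c * sumTo k (λ j → if j ≤ᵇ 0 then 0ℚ else f j * invUpTo m (k ∸ j)))

  psInv : PS
  psInv n = invUpTo n n

-- Quotient f / g of power series with f 0 = g 0 = 0 and g 1 ≠ 0:
-- f / g = (f / t) · (g / t)⁻¹
shift : PS → PS
shift f n = f (suc n)

psDiv : (f g : PS) → .{{NonZero (g 1)}} → PS
psDiv f g = shift f ⊛ psInv (shift g)

expPS : ℚ → PS
expPS x n = (x ^ n) * invFact n

falling : ℚ → ℕ → ℚ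
falling x zero    = 1ℚ
falling x (suc n) = falling x n * (x - ℕ→ℚ n)

-- (1+t)^x = Σ_n binom(x,n) t^n
binomPS : ℚ → PS
binomPS x n = falling x n * invFact n

logPS : PS
logPS zero    = 0ℚ
logPS (suc n) = sgn n * (+ 1 / suc n)

onePlusT : PS
onePlusT = onePS ⊕ tPS

onePlusTInv : PS
onePlusTInv n = sgn n

-- e^t - e^{-t}   (coefficient of t is 2)
expDiff : PS
expDiff = expPS 1ℚ ⊖ expPS (- 1ℚ)

-- (1+t) - (1+t)^{-1}   (coefficient of t is 2)
daeheeDen : PS
daeheeDen = onePlusT ⊖ onePlusTInv

bernoulli2 : ℚ → ℕ → ℚ
bernoulli2 x n = factℚ n * (psDiv tPS expDiff ⊛ expPS x) n

daehee2 : ℚ → ℕ → ℚ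
daehee2 x n = factℚ n * (psDiv logPS daeheeDen ⊛ binomPS x) n

-- Signed Stirling numbers of the first kind:
-- (log(1+t))^l / l! = Σ_n S1(n,l) t^n/n!
S1 : ℕ → ℕ → ℚ
S1 n l = factℚ n * (psPow logPS l n * invFact l)

-- Substituting t ↦ log(1 + t) turns e^t into 1 + t, hence t / (e^t − e^{−t}) · e^{xt} into
-- log(1 + t) / ((1 + t) − (1 + t)^{−1}) · (1 + t)^x, while on Σ b_l(x) t^l / l! it produces
-- Σ_l b_l(x) log(1 + t)^l / l! = Σ_n (Σ_l S1(n, l) b_l(x)) t^n / n!.
-- Coefficientwise the substitution c ↦ Σ_l c_l log(1 + t)^l is a finite sum, and it is
-- multiplicative.  It sends e^{xt} to (1 + t)^x because, as (1 + t) d/dt log(1 + t) = 1,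
-- both sides solve (1 + t) F′ = x F with F(0) = 1, and that equation determines F.
-- Quotients transfer since they are characterised by f = (f / g) g once t is cancelled.

module Submission where

open import Defs
open import Data.Nat using (ℕ)
open import Data.Rational using (ℚ; 0ℚ; _*_)
open import Data.Product using (_×_)
open import Relation.Binary.PropositionalEquality using (_≡_)

open import Data.Bool using (false; if_then_else_)
open import Data.Bool.Properties using (T-≡)
open import Data.Integer as ℤ using (+_)
import Data.Integer.Properties as ℤ
import Data.Integer.Tactic.RingSolver as ℤ-Solver
open import Data.Maybe using (Maybe; just; nothing)
open import Data.Nat as ℕ using (zero; suc; _∸_; _≤_; _<_; z≤n; s≤s; _≡ᵇ_; _≤ᵇ_; _≤?_; _!)
import Data.Nat.Properties as ℕ
open import Data.Product using (_,_)
open import Data.Rational using (1ℚ; _+_; -_; _-_; _/_; 1/_; NonZero; toℚᵘ)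
import Data.Rational.Properties as ℚ
import Data.Rational.Unnormalised as ℚᵘ
import Data.Rational.Unnormalised.Properties as ℚᵘ
open import Data.Sum using (inj₁; inj₂)
open import Function using (_∘_)
open import Function.Bundles using (Equivalence)
open import Level using (0ℓ)
open import Relation.Binary.PropositionalEquality using (refl; sym; trans; cong; cong₂; _≢_; module ≡-Reasoning)
open import Relation.Nullary using (yes; no; contradiction)
open import Tactic.RingSolver using (solve-∀)
import Tactic.RingSolver.Core.AlmostCommutativeRing as ACR

open ≡-Reasoning

ℚ-ring : ACR.AlmostCommutativeRing 0ℓ 0ℓ
ℚ-ring = ACR.fromCommutativeRing ℚ.+-*-commutativeRing isZero
  where
  isZero : ∀ x → Maybe (0ℚ ≡ x)
  isZero x with 0ℚ ℚ.≟ x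
  ... | yes 0≡x = just 0≡x
  ... | no _    = nothing

toℚᵘ-ℕ/suc : ∀ a b → toℚᵘ (+ a / suc b) ℚᵘ.≃ ℚᵘ.mkℚᵘ (+ a) b
toℚᵘ-ℕ/suc a b = ℚ.toℚᵘ-fromℚᵘ (ℚᵘ.mkℚᵘ (+ a) b)

ℕ→ℚ-suc : ∀ n → ℕ→ℚ (suc n) ≡ 1ℚ + ℕ→ℚ n
ℕ→ℚ-suc n = ℚ.toℚᵘ-injective
  (ℚᵘ.≃-trans (toℚᵘ-ℕ/suc (suc n) 0) (ℚᵘ.≃-trans (ℚᵘ.*≡* (cross (+ n))) (ℚᵘ.≃-sym
    (ℚᵘ.≃-trans (ℚ.toℚᵘ-homo-+ 1ℚ (ℕ→ℚ n)) (ℚᵘ.+-cong (toℚᵘ-ℕ/suc 1 0) (toℚᵘ-ℕ/suc n 0))))))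
  where
  cross : ∀ m → (+ 1 ℤ.+ m) ℤ.* + 1 ≡ (+ 1 ℤ.* + 1 ℤ.+ m ℤ.* + 1) ℤ.* + 1
  cross = ℤ-Solver.solve-∀

1/n*n≡1 : ∀ n → (+ 1 / suc n) * ℕ→ℚ (suc n) ≡ 1ℚ
1/n*n≡1 n = ℚ.toℚᵘ-injective (ℚᵘ.≃-trans (ℚ.toℚᵘ-homo-* (+ 1 / suc n) (ℕ→ℚ (suc n)))
  (ℚᵘ.≃-trans (ℚᵘ.*-cong (toℚᵘ-ℕ/suc 1 n) (toℚᵘ-ℕ/suc (suc n) 0)) (ℚᵘ.*≡* cross)))
  where
  cross : (+ 1 ℤ.* + suc n) ℤ.* + 1 ≡ + 1 ℤ.* + (suc n ℕ.* 1)
  cross rewrite ℕ.*-identityʳ n = ℤ.*-identityʳ (+ 1 ℤ.* + suc n)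

n*1/n≡1 : ∀ n → ℕ→ℚ (suc n) * (+ 1 / suc n) ≡ 1ℚ
n*1/n≡1 n = trans (ℚ.*-comm (ℕ→ℚ (suc n)) (+ 1 / suc n)) (1/n*n≡1 n)

ℕ→ℚ-+ : ∀ m n → ℕ→ℚ (m ℕ.+ n) ≡ ℕ→ℚ m + ℕ→ℚ n
ℕ→ℚ-+ zero    n = sym (ℚ.+-identityˡ (ℕ→ℚ n))
ℕ→ℚ-+ (suc m) n = begin
  ℕ→ℚ (suc (m ℕ.+ n))          ≡⟨ ℕ→ℚ-suc (m ℕ.+ n) ⟩
  1ℚ + ℕ→ℚ (m ℕ.+ n)           ≡⟨ cong (_+_ 1ℚ) (ℕ→ℚ-+ m n) ⟩
  1ℚ + (ℕ→ℚ m + ℕ→ℚ n)         ≡⟨ ℚ.+-assoc 1ℚ (ℕ→ℚ m) (ℕ→ℚ n) ⟨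
  (1ℚ + ℕ→ℚ m) + ℕ→ℚ n         ≡⟨ cong (_+ ℕ→ℚ n) (ℕ→ℚ-suc m) ⟨
  ℕ→ℚ (suc m) + ℕ→ℚ n          ∎

ℕ→ℚ-* : ∀ m n → ℕ→ℚ (m ℕ.* n) ≡ ℕ→ℚ m * ℕ→ℚ n
ℕ→ℚ-* zero    n = sym (ℚ.*-zeroˡ (ℕ→ℚ n))
ℕ→ℚ-* (suc m) n = begin
  ℕ→ℚ (n ℕ.+ m ℕ.* n)           ≡⟨ ℕ→ℚ-+ n (m ℕ.* n) ⟩
  ℕ→ℚ n + ℕ→ℚ (m ℕ.* n)         ≡⟨ cong (_+_ (ℕ→ℚ n)) (ℕ→ℚ-* m n) ⟩
  ℕ→ℚ n + ℕ→ℚ m * ℕ→ℚ n         ≡⟨ ring (ℕ→ℚ n) (ℕ→ℚ m) ⟩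
  (1ℚ + ℕ→ℚ m) * ℕ→ℚ n          ≡⟨ cong (_* ℕ→ℚ n) (ℕ→ℚ-suc m) ⟨
  ℕ→ℚ (suc m) * ℕ→ℚ n           ∎
  where
  ring : ∀ a b → a + b * a ≡ (1ℚ + b) * a
  ring = solve-∀ ℚ-ring

factℚ*invFact≡1 : ∀ n → factℚ n * invFact n ≡ 1ℚ
factℚ*invFact≡1 zero    = refl
factℚ*invFact≡1 (suc n) = begin
  factℚ (suc n) * (invFact n * (+ 1 / suc n))
    ≡⟨ cong (_* (invFact n * (+ 1 / suc n))) (ℕ→ℚ-* (suc n) (n !)) ⟩
  (ℕ→ℚ (suc n) * factℚ n) * (invFact n * (+ 1 / suc n))
    ≡⟨ ring (ℕ→ℚ (suc n)) (factℚ n) (invFact n) (+ 1 / suc n) ⟩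
  (factℚ n * invFact n) * (ℕ→ℚ (suc n) * (+ 1 / suc n))
    ≡⟨ cong₂ _*_ (factℚ*invFact≡1 n) (n*1/n≡1 n) ⟩
  1ℚ ∎
  where
  ring : ∀ a b c d → (a * b) * (c * d) ≡ (b * c) * (a * d)
  ring = solve-∀ ℚ-ring

sumTo-cong-≤ : ∀ n {f g : ℕ → ℚ} → (∀ k → k ≤ n → f k ≡ g k) → sumTo n f ≡ sumTo n g
sumTo-cong-≤ zero    f≡g = f≡g 0 z≤n
sumTo-cong-≤ (suc n) f≡g =
  cong₂ _+_ (sumTo-cong-≤ n (λ k k≤n → f≡g k (ℕ.m≤n⇒m≤1+n k≤n))) (f≡g (suc n) ℕ.≤-refl)

sumTo-cong : ∀ n {f g : ℕ → ℚ} → (∀ k → f k ≡ g k) → sumTo n f ≡ sumTo n g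
sumTo-cong n f≡g = sumTo-cong-≤ n (λ k _ → f≡g k)

sumTo-zero : ∀ n (f : ℕ → ℚ) → (∀ k → k ≤ n → f k ≡ 0ℚ) → sumTo n f ≡ 0ℚ
sumTo-zero zero    f f≡0 = f≡0 0 z≤n
sumTo-zero (suc n) f f≡0 =
  cong₂ _+_ (sumTo-zero n f (λ k k≤n → f≡0 k (ℕ.m≤n⇒m≤1+n k≤n))) (f≡0 (suc n) ℕ.≤-refl)

sumTo-+ : ∀ n (f g : ℕ → ℚ) → sumTo n (λ k → f k + g k) ≡ sumTo n f + sumTo n g
sumTo-+ zero    f g = refl
sumTo-+ (suc n) f g = trans (cong (_+ (f (suc n) + g (suc n))) (sumTo-+ n f g))
  (ring (sumTo n f) (sumTo n g) (f (suc n)) (g (suc n)))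
  where
  ring : ∀ a b c d → (a + b) + (c + d) ≡ (a + c) + (b + d)
  ring = solve-∀ ℚ-ring

sumTo-- : ∀ n (f g : ℕ → ℚ) → sumTo n (λ k → f k - g k) ≡ sumTo n f - sumTo n g
sumTo-- zero    f g = refl
sumTo-- (suc n) f g = trans (cong (_+ (f (suc n) - g (suc n))) (sumTo-- n f g))
  (ring (sumTo n f) (sumTo n g) (f (suc n)) (g (suc n)))
  where
  ring : ∀ a b c d → (a - b) + (c - d) ≡ (a + c) - (b + d)
  ring = solve-∀ ℚ-ring

*-distribˡ-sumTo : ∀ n c (f : ℕ → ℚ) → c * sumTo n f ≡ sumTo n (λ k → c * f k)
*-distribˡ-sumTo zero    c f = refl
*-distribˡ-sumTo (suc n) c f = trans (ℚ.*-distribˡ-+ c (sumTo n f) (f (suc n)))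
  (cong (_+ c * f (suc n)) (*-distribˡ-sumTo n c f))

*-distribʳ-sumTo : ∀ n c (f : ℕ → ℚ) → sumTo n f * c ≡ sumTo n (λ k → f k * c)
*-distribʳ-sumTo zero    c f = refl
*-distribʳ-sumTo (suc n) c f = trans (ℚ.*-distribʳ-+ c (sumTo n f) (f (suc n)))
  (cong (_+ f (suc n) * c) (*-distribʳ-sumTo n c f))

sumTo-sucˡ : ∀ n (f : ℕ → ℚ) → sumTo (suc n) f ≡ f 0 + sumTo n (f ∘ suc)
sumTo-sucˡ zero    f = refl
sumTo-sucˡ (suc n) f = trans (cong (_+ f (suc (suc n))) (sumTo-sucˡ n f))
  (ℚ.+-assoc (f 0) (sumTo n (f ∘ suc)) (f (suc (suc n))))

sumTo-swap : ∀ n m (f : ℕ → ℕ → ℚ) →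
  sumTo n (λ i → sumTo m (f i)) ≡ sumTo m (λ j → sumTo n (λ i → f i j))
sumTo-swap zero    m f = refl
sumTo-swap (suc n) m f = trans (cong (_+ sumTo m (f (suc n))) (sumTo-swap n m f))
  (sym (sumTo-+ m (λ j → sumTo n (λ i → f i j)) (f (suc n))))

sumTo-extend : ∀ {n m} (f : ℕ → ℚ) → n ≤ m → (∀ k → n < k → f k ≡ 0ℚ) → sumTo m f ≡ sumTo n f
sumTo-extend {zero}  {zero}  f _ _ = refl
sumTo-extend {n}     {suc m} f n≤1+m tail≡0 with ℕ.m≤n⇒m<n∨m≡n n≤1+m
... | inj₂ refl = refl
... | inj₁ (s≤s n≤m) = begin
  sumTo m f + f (suc m) ≡⟨ cong₂ _+_ (sumTo-extend f n≤m tail≡0) (tail≡0 (suc m) (s≤s n≤m)) ⟩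
  sumTo n f + 0ℚ        ≡⟨ ℚ.+-identityʳ (sumTo n f) ⟩
  sumTo n f             ∎

*-distribˡ-sumTo₂ : ∀ n m c (f : ℕ → ℕ → ℚ) →
  c * sumTo n (λ i → sumTo m (f i)) ≡ sumTo n (λ i → sumTo m (λ j → c * f i j))
*-distribˡ-sumTo₂ n m c f =
  trans (*-distribˡ-sumTo n c _) (sumTo-cong n (λ i → *-distribˡ-sumTo m c (f i)))

*-distribʳ-sumTo₂ : ∀ n m c (f : ℕ → ℕ → ℚ) →
  sumTo n (λ i → sumTo m (f i)) * c ≡ sumTo n (λ i → sumTo m (λ j → f i j * c))
*-distribʳ-sumTo₂ n m c f =
  trans (*-distribʳ-sumTo n c _) (sumTo-cong n (λ i → *-distribʳ-sumTo m c (f i)))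

sumTo-*-sumTo : ∀ n m (f g : ℕ → ℚ) → sumTo n f * sumTo m g ≡ sumTo n (λ i → sumTo m (λ j → f i * g j))
sumTo-*-sumTo n m f g =
  trans (*-distribʳ-sumTo n (sumTo m g) f) (sumTo-cong n (λ i → *-distribˡ-sumTo m (f i) g))

sumTo₂-+ : ∀ n m (f g : ℕ → ℕ → ℚ) →
  sumTo n (λ i → sumTo m (λ j → f i j + g i j)) ≡
  sumTo n (λ i → sumTo m (f i)) + sumTo n (λ i → sumTo m (g i))
sumTo₂-+ n m f g = trans (sumTo-cong n (λ i → sumTo-+ m (f i) (g i))) (sumTo-+ n _ _)

sumTo-interchange₄ : ∀ n (f : ℕ → ℕ → ℕ → ℕ → ℚ) →
  sumTo n (λ a → sumTo n (λ b → sumTo n (λ c → sumTo n (λ d → f a b c d)))) ≡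
  sumTo n (λ c → sumTo n (λ d → sumTo n (λ b → sumTo n (λ a → f a b c d))))
sumTo-interchange₄ n f = begin
  sumTo n (λ a → sumTo n (λ b → sumTo n (λ c → sumTo n (λ d → f a b c d))))
    ≡⟨ sumTo-cong n (λ a → sumTo-swap n n _) ⟩
  sumTo n (λ a → sumTo n (λ c → sumTo n (λ b → sumTo n (λ d → f a b c d))))
    ≡⟨ sumTo-cong n (λ a → sumTo-cong n (λ c → sumTo-swap n n _)) ⟩
  sumTo n (λ a → sumTo n (λ c → sumTo n (λ d → sumTo n (λ b → f a b c d))))
    ≡⟨ sumTo-swap n n _ ⟩
  sumTo n (λ c → sumTo n (λ a → sumTo n (λ d → sumTo n (λ b → f a b c d))))
    ≡⟨ sumTo-cong n (λ c → sumTo-swap n n _) ⟩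
  sumTo n (λ c → sumTo n (λ d → sumTo n (λ a → sumTo n (λ b → f a b c d))))
    ≡⟨ sumTo-cong n (λ c → sumTo-cong n (λ d → sumTo-swap n n _)) ⟩
  sumTo n (λ c → sumTo n (λ d → sumTo n (λ b → sumTo n (λ a → f a b c d)))) ∎

δ : ℕ → ℕ → ℚ
δ a b = if a ≡ᵇ b then 1ℚ else 0ℚ

δ-sym : ∀ a b → δ a b ≡ δ b a
δ-sym zero    zero    = refl
δ-sym zero    (suc b) = refl
δ-sym (suc a) zero    = refl
δ-sym (suc a) (suc b) = δ-sym a b

δ-refl : ∀ a → δ a a ≡ 1ℚ
δ-refl zero    = refl
δ-refl (suc a) = δ-refl a

δ-≢ : ∀ {a b} → a ≢ b → δ a b ≡ 0ℚ
δ-≢ {zero}  {zero}  a≢b = contradiction refl a≢b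
δ-≢ {zero}  {suc b} _   = refl
δ-≢ {suc a} {zero}  _   = refl
δ-≢ {suc a} {suc b} a≢b = δ-≢ (a≢b ∘ cong suc)

δ-+ˡ : ∀ i j n → δ (i ℕ.+ j) (i ℕ.+ n) ≡ δ j n
δ-+ˡ zero    j n = refl
δ-+ˡ (suc i) j n = δ-+ˡ i j n

δ-+-> : ∀ {a n} b → n < a → δ (a ℕ.+ b) n ≡ 0ℚ
δ-+-> {a} b n<a = δ-≢ (ℕ.>⇒≢ (ℕ.<-≤-trans n<a (ℕ.m≤m+n a b)))

δ*-≢ : ∀ {a b} x → a ≢ b → δ a b * x ≡ 0ℚ
δ*-≢ x a≢b = trans (cong (_* x) (δ-≢ a≢b)) (ℚ.*-zeroˡ x)

δ*-transport : ∀ a b (g : ℕ → ℚ) → δ a b * g b ≡ δ a b * g a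
δ*-transport a b g with a ℕ.≟ b
... | yes refl = refl
... | no  a≢b  = trans (δ*-≢ (g b) a≢b) (sym (δ*-≢ (g a) a≢b))

sumTo-δ : ∀ n m (g : ℕ → ℚ) → (n < m → g m ≡ 0ℚ) → sumTo n (λ j → δ j m * g j) ≡ g m
sumTo-δ n m g g-out with m ≤? n
... | no  m≰n = trans
  (sumTo-zero n _ (λ k k≤n → δ*-≢ (g k) (ℕ.<⇒≢ (ℕ.≤-<-trans k≤n (ℕ.≰⇒> m≰n)))))
  (sym (g-out (ℕ.≰⇒> m≰n)))
... | yes m≤n = trans (sumTo-extend _ m≤n (λ k m<k → δ*-≢ (g k) (ℕ.>⇒≢ m<k))) (diagonal m)
  where
  diagonal : ∀ m → sumTo m (λ j → δ j m * g j) ≡ g m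
  diagonal zero    = ℚ.*-identityˡ (g 0)
  diagonal (suc m) = begin
    sumTo m (λ j → δ j (suc m) * g j) + δ (suc m) (suc m) * g (suc m)
      ≡⟨ cong₂ _+_ (sumTo-zero m _ (λ k k≤m → δ*-≢ (g k) (ℕ.<⇒≢ (s≤s k≤m))))
                   (trans (cong (_* g (suc m)) (δ-refl m)) (ℚ.*-identityˡ (g (suc m)))) ⟩
    0ℚ + g (suc m) ≡⟨ ℚ.+-identityˡ (g (suc m)) ⟩
    g (suc m)      ∎

-- The Cauchy product

infix 4 _≈_
_≈_ : PS → PS → Set
f ≈ g = ∀ n → f n ≡ g n

infixl 7 _·_
_·_ : ℚ → PS → PS
(c · f) n = c * f n

zeroPS : PS
zeroPS _ = 0ℚ

⊛-cong : ∀ {f f′ g g′} → f ≈ f′ → g ≈ g′ → f ⊛ g ≈ f′ ⊛ g′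
⊛-cong f≈f′ g≈g′ n = sumTo-cong n (λ k → cong₂ _*_ (f≈f′ k) (g≈g′ (n ∸ k)))

⊛-congˡ : ∀ {f f′} g → f ≈ f′ → f ⊛ g ≈ f′ ⊛ g
⊛-congˡ {f} {f′} g f≈f′ = ⊛-cong {f} {f′} {g} {g} f≈f′ (λ _ → refl)

⊛-congʳ : ∀ f {g g′} → g ≈ g′ → f ⊛ g ≈ f ⊛ g′
⊛-congʳ f {g} {g′} = ⊛-cong {f} {f} {g} {g′} (λ _ → refl)

-- Writing (f ⊛ g) n as a sum over a full square [0,N] × [0,M] cut down by δ (i + j) n
-- turns the reindexings of Cauchy products into interchanges of finite sums.
⊛-as-δ-sum : ∀ N M n (f g : PS) → n ≤ N → n ≤ M →
  (f ⊛ g) n ≡ sumTo N (λ i → sumTo M (λ j → δ (i ℕ.+ j) n * (f i * g j)))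
⊛-as-δ-sum N M n f g n≤N n≤M = sym (trans
  (sumTo-extend _ n≤N (λ i n<i → sumTo-zero M _ (λ j _ → trans (cong (_* (f i * g j)) (δ-+-> j n<i))
                                                                 (ℚ.*-zeroˡ (f i * g j)))))
  (sumTo-cong-≤ n row))
  where
  row : ∀ i → i ≤ n → sumTo M (λ j → δ (i ℕ.+ j) n * (f i * g j)) ≡ f i * g (n ∸ i)
  row i i≤n = trans
    (sumTo-cong M (λ j → cong (λ m → δ (i ℕ.+ j) m * (f i * g j)) (sym (ℕ.m+[n∸m]≡n i≤n))))
    (trans (sumTo-cong M (λ j → cong (_* (f i * g j)) (δ-+ˡ i j (n ∸ i))))
           (sumTo-δ M (n ∸ i) (λ j → f i * g j)
             (λ M<n-i → contradiction (ℕ.≤-trans (ℕ.m∸n≤m n i) n≤M) (ℕ.<⇒≱ M<n-i))))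

⊛-as-δ-squareSum : ∀ n (f g : PS) →
  (f ⊛ g) n ≡ sumTo n (λ i → sumTo n (λ j → δ (i ℕ.+ j) n * (f i * g j)))
⊛-as-δ-squareSum n f g = ⊛-as-δ-sum n n n f g ℕ.≤-refl ℕ.≤-refl

⊛-comm : ∀ f g → f ⊛ g ≈ g ⊛ f
⊛-comm f g n = begin
  (f ⊛ g) n                                                     ≡⟨ ⊛-as-δ-squareSum n f g ⟩
  sumTo n (λ i → sumTo n (λ j → δ (i ℕ.+ j) n * (f i * g j)))   ≡⟨ sumTo-swap n n _ ⟩
  sumTo n (λ j → sumTo n (λ i → δ (i ℕ.+ j) n * (f i * g j)))
    ≡⟨ sumTo-cong n (λ j → sumTo-cong n (λ i →
         cong₂ _*_ (cong (λ m → δ m n) (ℕ.+-comm i j)) (ℚ.*-comm (f i) (g j)))) ⟩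
  sumTo n (λ j → sumTo n (λ i → δ (j ℕ.+ i) n * (g j * f i)))   ≡⟨ ⊛-as-δ-squareSum n g f ⟨
  (g ⊛ f) n                                                     ∎

⊛₃ : PS → PS → PS → PS
⊛₃ f g h n = sumTo n (λ a → sumTo n (λ b → sumTo n (λ c → δ ((a ℕ.+ b) ℕ.+ c) n * ((f a * g b) * h c))))

⊛-⊛≈⊛₃ : ∀ f g h → (f ⊛ g) ⊛ h ≈ ⊛₃ f g h
⊛-⊛≈⊛₃ f g h n = begin
  ((f ⊛ g) ⊛ h) n
    ≡⟨ ⊛-as-δ-squareSum n (f ⊛ g) h ⟩
  sumTo n (λ k → sumTo n (λ c → δ (k ℕ.+ c) n * ((f ⊛ g) k * h c)))
    ≡⟨ sumTo-cong-≤ n (λ k k≤n → sumTo-cong n (λ c → expand k c (⊛-as-δ-sum n n k f g k≤n k≤n))) ⟩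
  sumTo n (λ k → sumTo n (λ c → sumTo n (λ a → sumTo n (λ b →
    δ (k ℕ.+ c) n * ((δ (a ℕ.+ b) k * (f a * g b)) * h c)))))
    ≡⟨ sumTo-interchange₄ n _ ⟩
  sumTo n (λ a → sumTo n (λ b → sumTo n (λ c → sumTo n (λ k →
    δ (k ℕ.+ c) n * ((δ (a ℕ.+ b) k * (f a * g b)) * h c)))))
    ≡⟨ sumTo-cong n (λ a → sumTo-cong n (λ b → sumTo-cong n (λ c →
         contract (a ℕ.+ b) c (f a * g b) (h c)))) ⟩
  ⊛₃ f g h n ∎
  where
  expand : ∀ k c {u} → (f ⊛ g) k ≡ sumTo n (λ a → sumTo n (λ b → u a b)) →
    δ (k ℕ.+ c) n * ((f ⊛ g) k * h c) ≡ sumTo n (λ a → sumTo n (λ b → δ (k ℕ.+ c) n * (u a b * h c)))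
  expand k c {u} fg≡ = trans (cong (λ s → δ (k ℕ.+ c) n * (s * h c)) fg≡)
    (trans (cong (δ (k ℕ.+ c) n *_) (*-distribʳ-sumTo₂ n n (h c) u)) (*-distribˡ-sumTo₂ n n (δ (k ℕ.+ c) n) _))
  reassoc : ∀ d e p q → d * ((e * p) * q) ≡ e * (d * (p * q))
  reassoc = solve-∀ ℚ-ring
  contract : ∀ m c p q → sumTo n (λ k → δ (k ℕ.+ c) n * ((δ m k * p) * q)) ≡ δ (m ℕ.+ c) n * (p * q)
  contract m c p q = trans
    (sumTo-cong n (λ k → trans (reassoc (δ (k ℕ.+ c) n) (δ m k) p q) (cong (_* _) (δ-sym m k))))
    (sumTo-δ n m (λ k → δ (k ℕ.+ c) n * (p * q))
      (λ n<m → trans (cong (_* (p * q)) (δ-+-> c n<m)) (ℚ.*-zeroˡ (p * q))))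

⊛₃-rotate : ∀ f g h → ⊛₃ g h f ≈ ⊛₃ f g h
⊛₃-rotate f g h n = begin
  ⊛₃ g h f n
    ≡⟨ sumTo-cong n (λ b → sumTo-swap n n _) ⟩
  sumTo n (λ b → sumTo n (λ a → sumTo n (λ c → δ ((b ℕ.+ c) ℕ.+ a) n * ((g b * h c) * f a))))
    ≡⟨ sumTo-swap n n _ ⟩
  sumTo n (λ a → sumTo n (λ b → sumTo n (λ c → δ ((b ℕ.+ c) ℕ.+ a) n * ((g b * h c) * f a))))
    ≡⟨ sumTo-cong n (λ a → sumTo-cong n (λ b → sumTo-cong n (λ c →
         cong₂ _*_ (cong (λ m → δ m n) (+-rotate a b c)) (*-rotate (f a) (g b) (h c))))) ⟩
  ⊛₃ f g h n ∎
  where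
  +-rotate : ∀ a b c → (b ℕ.+ c) ℕ.+ a ≡ (a ℕ.+ b) ℕ.+ c
  +-rotate a b c = trans (ℕ.+-comm (b ℕ.+ c) a) (sym (ℕ.+-assoc a b c))
  *-rotate : ∀ x y z → (y * z) * x ≡ (x * y) * z
  *-rotate = solve-∀ ℚ-ring

⊛-assoc : ∀ f g h → f ⊛ (g ⊛ h) ≈ (f ⊛ g) ⊛ h
⊛-assoc f g h n = begin
  (f ⊛ (g ⊛ h)) n ≡⟨ ⊛-comm f (g ⊛ h) n ⟩
  ((g ⊛ h) ⊛ f) n ≡⟨ ⊛-⊛≈⊛₃ g h f n ⟩
  ⊛₃ g h f n      ≡⟨ ⊛₃-rotate f g h n ⟩
  ⊛₃ f g h n      ≡⟨ ⊛-⊛≈⊛₃ f g h n ⟨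
  ((f ⊛ g) ⊛ h) n ∎

⊛-distribˡ-⊕ : ∀ f g h → f ⊛ (g ⊕ h) ≈ (f ⊛ g) ⊕ (f ⊛ h)
⊛-distribˡ-⊕ f g h n =
  trans (sumTo-cong n (λ k → ℚ.*-distribˡ-+ (f k) (g (n ∸ k)) (h (n ∸ k)))) (sumTo-+ n _ _)

⊛-·ʳ : ∀ c f g → f ⊛ (c · g) ≈ c · (f ⊛ g)
⊛-·ʳ c f g n = trans (sumTo-cong n (λ k → ring c (f k) (g (n ∸ k)))) (sym (*-distribˡ-sumTo n c _))
  where
  ring : ∀ c a b → a * (c * b) ≡ c * (a * b)
  ring = solve-∀ ℚ-ring

⊛-zeroʳ : ∀ f → f ⊛ zeroPS ≈ zeroPS
⊛-zeroʳ f n = sumTo-zero n _ (λ k _ → ℚ.*-zeroʳ (f k))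

⊛-identityˡ : ∀ f → onePS ⊛ f ≈ f
⊛-identityˡ f zero    = ℚ.*-identityˡ (f 0)
⊛-identityˡ f (suc n) = begin
  (onePS ⊛ f) (suc n)
    ≡⟨ sumTo-sucˡ n _ ⟩
  1ℚ * f (suc n) + sumTo n (λ k → 0ℚ * f (n ∸ k))
    ≡⟨ cong₂ _+_ (ℚ.*-identityˡ (f (suc n))) (sumTo-zero n _ (λ k _ → ℚ.*-zeroˡ (f (n ∸ k)))) ⟩
  f (suc n) + 0ℚ
    ≡⟨ ℚ.+-identityʳ (f (suc n)) ⟩
  f (suc n) ∎

⊛-identityʳ : ∀ f → f ⊛ onePS ≈ f
⊛-identityʳ f n = trans (⊛-comm f onePS n) (⊛-identityˡ f n)

t⊛-shift : ∀ f n → (tPS ⊛ f) (suc n) ≡ f n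
t⊛-shift f n = begin
  (tPS ⊛ f) (suc n)
    ≡⟨ sumTo-sucˡ n _ ⟩
  0ℚ * f (suc n) + sumTo n (λ k → tPS (suc k) * f (n ∸ k))
    ≡⟨ cong (_+_ (0ℚ * f (suc n))) (sumTo-cong n (λ { zero → refl ; (suc _) → refl })) ⟩
  0ℚ * f (suc n) + (onePS ⊛ f) n
    ≡⟨ cong₂ _+_ (ℚ.*-zeroˡ (f (suc n))) (⊛-identityˡ f n) ⟩
  0ℚ + f n
    ≡⟨ ℚ.+-identityˡ (f n) ⟩
  f n ∎

t⊛-shift≈ : ∀ f → f 0 ≡ 0ℚ → f ≈ tPS ⊛ shift f
t⊛-shift≈ f f0≡0 zero    = trans f0≡0 (sym (ℚ.*-zeroˡ (f 1)))
t⊛-shift≈ f f0≡0 (suc n) = sym (t⊛-shift (shift f) n)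

invUpTo-stable : ∀ f .{{_ : NonZero (f 0)}} {m k} → k ≤ m → invUpTo f m k ≡ psInv f k
invUpTo-stable f {zero}  {zero} z≤n = refl
invUpTo-stable f {suc m} {k}    k≤1+m with ℕ.m≤n⇒m<n∨m≡n k≤1+m
... | inj₂ refl = refl
... | inj₁ (s≤s k≤m) rewrite Equivalence.to T-≡ (ℕ.≤⇒≤ᵇ k≤m) = invUpTo-stable f k≤m

1+n≤ᵇn≡false : ∀ n → (suc n ≤ᵇ n) ≡ false
1+n≤ᵇn≡false zero    = refl
1+n≤ᵇn≡false (suc n) = 1+n≤ᵇn≡false n

f0*psInv-suc : ∀ f .{{_ : NonZero (f 0)}} n →
  f 0 * psInv f (suc n) ≡ - sumTo n (λ j → f (suc j) * psInv f (n ∸ j))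
f0*psInv-suc f n rewrite 1+n≤ᵇn≡false n = begin
  f 0 * - (1/ (f 0) * sumTo (suc n) (λ j → if j ≤ᵇ 0 then 0ℚ else f j * invUpTo f n (suc n ∸ j)))
    ≡⟨ cong (λ s → f 0 * - (1/ (f 0) * s)) (trans (sumTo-sucˡ n _) (trans (ℚ.+-identityˡ _)
         (sumTo-cong n (λ j → cong (f (suc j) *_) (invUpTo-stable f (ℕ.m∸n≤m n j)))))) ⟩
  f 0 * - (1/ (f 0) * S)   ≡⟨ ring (f 0) (1/ (f 0)) S ⟩
  - ((f 0 * 1/ (f 0)) * S) ≡⟨ cong (λ c → - (c * S)) (ℚ.*-inverseʳ (f 0)) ⟩
  - (1ℚ * S)               ≡⟨ cong -_ (ℚ.*-identityˡ S) ⟩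
  - S                      ∎
  where
  S = sumTo n (λ j → f (suc j) * psInv f (n ∸ j))
  ring : ∀ a c s → a * - (c * s) ≡ - ((a * c) * s)
  ring = solve-∀ ℚ-ring

⊛-psInv : ∀ f .{{_ : NonZero (f 0)}} → f ⊛ psInv f ≈ onePS
⊛-psInv f zero    = ℚ.*-inverseʳ (f 0)
⊛-psInv f (suc n) = begin
  (f ⊛ psInv f) (suc n)    ≡⟨ sumTo-sucˡ n _ ⟩
  f 0 * psInv f (suc n) + S ≡⟨ cong (_+ S) (f0*psInv-suc f n) ⟩
  - S + S                   ≡⟨ ℚ.+-inverseˡ S ⟩
  0ℚ                        ∎
  where
  S = sumTo n (λ j → f (suc j) * psInv f (n ∸ j))

⊛-⊛-psInv : ∀ h s .{{_ : NonZero (s 0)}} → (h ⊛ s) ⊛ psInv s ≈ h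
⊛-⊛-psInv h s n = begin
  ((h ⊛ s) ⊛ psInv s) n ≡⟨ ⊛-assoc h s (psInv s) n ⟨
  (h ⊛ (s ⊛ psInv s)) n ≡⟨ ⊛-congʳ h (⊛-psInv s) n ⟩
  (h ⊛ onePS) n         ≡⟨ ⊛-identityʳ h n ⟩
  h n                   ∎

⊛-t⊛ : ∀ h k → h ⊛ (tPS ⊛ k) ≈ tPS ⊛ (h ⊛ k)
⊛-t⊛ h k n = begin
  (h ⊛ (tPS ⊛ k)) n ≡⟨ ⊛-assoc h tPS k n ⟩
  ((h ⊛ tPS) ⊛ k) n ≡⟨ ⊛-congˡ k (⊛-comm h tPS) n ⟩
  ((tPS ⊛ h) ⊛ k) n ≡⟨ ⊛-assoc tPS h k n ⟨
  (tPS ⊛ (h ⊛ k)) n ∎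

psDiv-⊛-shift : ∀ f g .{{_ : NonZero (g 1)}} → psDiv f g ⊛ shift g ≈ shift f
psDiv-⊛-shift f g n = begin
  ((shift f ⊛ psInv (shift g)) ⊛ shift g) n ≡⟨ ⊛-assoc (shift f) (psInv (shift g)) (shift g) n ⟨
  (shift f ⊛ (psInv (shift g) ⊛ shift g)) n
    ≡⟨ ⊛-congʳ (shift f) (λ m → trans (⊛-comm (psInv (shift g)) (shift g) m) (⊛-psInv (shift g) m)) n ⟩
  (shift f ⊛ onePS) n                       ≡⟨ ⊛-identityʳ (shift f) n ⟩
  shift f n                                 ∎

psDiv-⊛ : ∀ f g .{{_ : NonZero (g 1)}} → f 0 ≡ 0ℚ → g 0 ≡ 0ℚ → psDiv f g ⊛ g ≈ f
psDiv-⊛ f g f0≡0 g0≡0 n = begin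
  (psDiv f g ⊛ g) n                  ≡⟨ ⊛-congʳ (psDiv f g) (t⊛-shift≈ g g0≡0) n ⟩
  (psDiv f g ⊛ (tPS ⊛ shift g)) n    ≡⟨ ⊛-t⊛ (psDiv f g) (shift g) n ⟩
  (tPS ⊛ (psDiv f g ⊛ shift g)) n    ≡⟨ ⊛-congʳ tPS (psDiv-⊛-shift f g) n ⟩
  (tPS ⊛ shift f) n                  ≡⟨ t⊛-shift≈ f f0≡0 n ⟨
  f n                                ∎

psDiv-unique : ∀ f g h .{{_ : NonZero (g 1)}} → g 0 ≡ 0ℚ → h ⊛ g ≈ f → h ≈ psDiv f g
psDiv-unique f g h g0≡0 h⊛g≈f n = begin
  h n                                   ≡⟨ ⊛-⊛-psInv h (shift g) n ⟨
  ((h ⊛ shift g) ⊛ psInv (shift g)) n   ≡⟨ ⊛-congˡ (psInv (shift g)) h⊛sg≈sf n ⟩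
  (shift f ⊛ psInv (shift g)) n         ∎
  where
  h⊛sg≈sf : h ⊛ shift g ≈ shift f
  h⊛sg≈sf m = begin
    (h ⊛ shift g) m                 ≡⟨ t⊛-shift (h ⊛ shift g) m ⟨
    (tPS ⊛ (h ⊛ shift g)) (suc m)   ≡⟨ ⊛-t⊛ h (shift g) (suc m) ⟨
    (h ⊛ (tPS ⊛ shift g)) (suc m)   ≡⟨ ⊛-congʳ h (t⊛-shift≈ g g0≡0) (suc m) ⟨
    (h ⊛ g) (suc m)                 ≡⟨ h⊛g≈f (suc m) ⟩
    f (suc m)                       ∎

-- Derivations

∂ : PS → PS
∂ h n = ℕ→ℚ (suc n) * h (suc n)

-- On the δ-sum over [0,n+1]², the weight i kills the row i = 0 and shifts the others down.
δ-sum-weightˡ : ∀ f g n →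
  sumTo (suc n) (λ i → sumTo (suc n) (λ j → δ (i ℕ.+ j) (suc n) * (ℕ→ℚ i * (f i * g j)))) ≡ (∂ f ⊛ g) n
δ-sum-weightˡ f g n = begin
  sumTo (suc n) (λ i → sumTo (suc n) (λ j → δ (i ℕ.+ j) (suc n) * (ℕ→ℚ i * (f i * g j))))
    ≡⟨ sumTo-sucˡ n _ ⟩
  sumTo (suc n) (λ j → δ j (suc n) * (0ℚ * (f 0 * g j))) +
  sumTo n (λ a → sumTo (suc n) (λ j → δ (a ℕ.+ j) n * (ℕ→ℚ (suc a) * (f (suc a) * g j))))
    ≡⟨ cong₂ _+_ (sumTo-zero (suc n) _ (λ j _ → trans (cong (δ j (suc n) *_) (ℚ.*-zeroˡ (f 0 * g j)))
                                                       (ℚ.*-zeroʳ (δ j (suc n)))))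
                 (sumTo-cong n (λ a → sumTo-cong (suc n) (λ j →
                   cong (δ (a ℕ.+ j) n *_) (sym (ℚ.*-assoc (ℕ→ℚ (suc a)) (f (suc a)) (g j)))))) ⟩
  0ℚ + sumTo n (λ a → sumTo (suc n) (λ j → δ (a ℕ.+ j) n * (∂ f a * g j)))
    ≡⟨ ℚ.+-identityˡ _ ⟩
  sumTo n (λ a → sumTo (suc n) (λ j → δ (a ℕ.+ j) n * (∂ f a * g j)))
    ≡⟨ ⊛-as-δ-sum n (suc n) n (∂ f) g ℕ.≤-refl (ℕ.n≤1+n n) ⟨
  (∂ f ⊛ g) n ∎

δ-sum-weightʳ : ∀ f g n →
  sumTo (suc n) (λ i → sumTo (suc n) (λ j → δ (i ℕ.+ j) (suc n) * (ℕ→ℚ j * (f i * g j)))) ≡ (f ⊛ ∂ g) n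
δ-sum-weightʳ f g n = begin
  sumTo (suc n) (λ i → sumTo (suc n) (λ j → δ (i ℕ.+ j) (suc n) * (ℕ→ℚ j * (f i * g j))))
    ≡⟨ sumTo-swap (suc n) (suc n) _ ⟩
  sumTo (suc n) (λ j → sumTo (suc n) (λ i → δ (i ℕ.+ j) (suc n) * (ℕ→ℚ j * (f i * g j))))
    ≡⟨ sumTo-cong (suc n) (λ j → sumTo-cong (suc n) (λ i →
         cong₂ _*_ (cong (λ m → δ m (suc n)) (ℕ.+-comm i j)) (cong (ℕ→ℚ j *_) (ℚ.*-comm (f i) (g j))))) ⟩
  sumTo (suc n) (λ j → sumTo (suc n) (λ i → δ (j ℕ.+ i) (suc n) * (ℕ→ℚ j * (g j * f i))))
    ≡⟨ δ-sum-weightˡ g f n ⟩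
  (∂ g ⊛ f) n ≡⟨ ⊛-comm (∂ g) f n ⟩
  (f ⊛ ∂ g) n ∎

∂-⊛ : ∀ f g → ∂ (f ⊛ g) ≈ (∂ f ⊛ g) ⊕ (f ⊛ ∂ g)
∂-⊛ f g n = begin
  ℕ→ℚ (suc n) * (f ⊛ g) (suc n)
    ≡⟨ cong (ℕ→ℚ (suc n) *_) (⊛-as-δ-squareSum (suc n) f g) ⟩
  ℕ→ℚ (suc n) * sumTo (suc n) (λ i → sumTo (suc n) (λ j → δ (i ℕ.+ j) (suc n) * (f i * g j)))
    ≡⟨ *-distribˡ-sumTo₂ (suc n) (suc n) (ℕ→ℚ (suc n)) _ ⟩
  sumTo (suc n) (λ i → sumTo (suc n) (λ j → ℕ→ℚ (suc n) * (δ (i ℕ.+ j) (suc n) * (f i * g j))))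
    ≡⟨ sumTo-cong (suc n) (λ i → sumTo-cong (suc n) (λ j → split i j)) ⟩
  sumTo (suc n) (λ i → sumTo (suc n) (λ j →
    δ (i ℕ.+ j) (suc n) * (ℕ→ℚ i * (f i * g j)) + δ (i ℕ.+ j) (suc n) * (ℕ→ℚ j * (f i * g j))))
    ≡⟨ sumTo₂-+ (suc n) (suc n) _ _ ⟩
  sumTo (suc n) (λ i → sumTo (suc n) (λ j → δ (i ℕ.+ j) (suc n) * (ℕ→ℚ i * (f i * g j)))) +
  sumTo (suc n) (λ i → sumTo (suc n) (λ j → δ (i ℕ.+ j) (suc n) * (ℕ→ℚ j * (f i * g j))))
    ≡⟨ cong₂ _+_ (δ-sum-weightˡ f g n) (δ-sum-weightʳ f g n) ⟩
  (∂ f ⊛ g) n + (f ⊛ ∂ g) n ∎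
  where
  commute : ∀ x d p → x * (d * p) ≡ d * (x * p)
  commute = solve-∀ ℚ-ring
  distrib : ∀ d a b p → d * ((a + b) * p) ≡ d * (a * p) + d * (b * p)
  distrib = solve-∀ ℚ-ring
  split : ∀ i j → ℕ→ℚ (suc n) * (δ (i ℕ.+ j) (suc n) * (f i * g j)) ≡
      δ (i ℕ.+ j) (suc n) * (ℕ→ℚ i * (f i * g j)) + δ (i ℕ.+ j) (suc n) * (ℕ→ℚ j * (f i * g j))
  split i j = begin
    ℕ→ℚ (suc n) * (δ (i ℕ.+ j) (suc n) * (f i * g j))
      ≡⟨ commute (ℕ→ℚ (suc n)) (δ (i ℕ.+ j) (suc n)) (f i * g j) ⟩
    δ (i ℕ.+ j) (suc n) * (ℕ→ℚ (suc n) * (f i * g j))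
      ≡⟨ δ*-transport (i ℕ.+ j) (suc n) (λ m → ℕ→ℚ m * (f i * g j)) ⟩
    δ (i ℕ.+ j) (suc n) * (ℕ→ℚ (i ℕ.+ j) * (f i * g j))
      ≡⟨ cong (λ w → δ (i ℕ.+ j) (suc n) * (w * (f i * g j))) (ℕ→ℚ-+ i j) ⟩
    δ (i ℕ.+ j) (suc n) * ((ℕ→ℚ i + ℕ→ℚ j) * (f i * g j))
      ≡⟨ distrib (δ (i ℕ.+ j) (suc n)) (ℕ→ℚ i) (ℕ→ℚ j) (f i * g j) ⟩
    δ (i ℕ.+ j) (suc n) * (ℕ→ℚ i * (f i * g j)) + δ (i ℕ.+ j) (suc n) * (ℕ→ℚ j * (f i * g j)) ∎

Θ : PS → PS
Θ h = onePlusT ⊛ ∂ h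

Θ-coeff : ∀ h n → Θ h n ≡ ∂ h n + ℕ→ℚ n * h n
Θ-coeff h n = begin
  (onePlusT ⊛ ∂ h) n                  ≡⟨ ⊛-comm onePlusT (∂ h) n ⟩
  (∂ h ⊛ (onePS ⊕ tPS)) n             ≡⟨ ⊛-distribˡ-⊕ (∂ h) onePS tPS n ⟩
  (∂ h ⊛ onePS) n + (∂ h ⊛ tPS) n     ≡⟨ cong₂ _+_ (⊛-identityʳ (∂ h) n) (⊛-comm (∂ h) tPS n) ⟩
  ∂ h n + (tPS ⊛ ∂ h) n               ≡⟨ cong (_+_ (∂ h n)) (t⊛∂ n) ⟩
  ∂ h n + ℕ→ℚ n * h n                 ∎
  where
  t⊛∂ : ∀ n → (tPS ⊛ ∂ h) n ≡ ℕ→ℚ n * h n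
  t⊛∂ zero    = trans (ℚ.*-zeroˡ (∂ h 0)) (sym (ℚ.*-zeroˡ (h 0)))
  t⊛∂ (suc n) = t⊛-shift (∂ h) n

Θ-⊛ : ∀ f g → Θ (f ⊛ g) ≈ (Θ f ⊛ g) ⊕ (f ⊛ Θ g)
Θ-⊛ f g n = begin
  (onePlusT ⊛ ∂ (f ⊛ g)) n                            ≡⟨ ⊛-congʳ onePlusT (∂-⊛ f g) n ⟩
  (onePlusT ⊛ ((∂ f ⊛ g) ⊕ (f ⊛ ∂ g))) n
    ≡⟨ ⊛-distribˡ-⊕ onePlusT (∂ f ⊛ g) (f ⊛ ∂ g) n ⟩
  (onePlusT ⊛ (∂ f ⊛ g)) n + (onePlusT ⊛ (f ⊛ ∂ g)) n
    ≡⟨ cong₂ _+_ (⊛-assoc onePlusT (∂ f) g n) left ⟩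
  (Θ f ⊛ g) n + (f ⊛ Θ g) n                           ∎
  where
  left : (onePlusT ⊛ (f ⊛ ∂ g)) n ≡ (f ⊛ Θ g) n
  left = begin
    (onePlusT ⊛ (f ⊛ ∂ g)) n ≡⟨ ⊛-assoc onePlusT f (∂ g) n ⟩
    ((onePlusT ⊛ f) ⊛ ∂ g) n ≡⟨ ⊛-congˡ (∂ g) (⊛-comm onePlusT f) n ⟩
    ((f ⊛ onePlusT) ⊛ ∂ g) n ≡⟨ ⊛-assoc f onePlusT (∂ g) n ⟨
    (f ⊛ Θ g) n              ∎

-- Composition with log(1 + t)

logPow : ℕ → PS
logPow = psPow logPS

logPow-low : ∀ {l n} → n < l → logPow l n ≡ 0ℚ
logPow-low {suc l} {zero}  _           = ℚ.*-zeroˡ (logPow l 0)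
logPow-low {suc l} {suc n} (s≤s n<l) = sumTo-zero (suc n) _ term
  where
  term : ∀ k → k ≤ suc n → logPS k * logPow l (suc n ∸ k) ≡ 0ℚ
  term zero    _ = ℚ.*-zeroˡ (logPow l (suc n))
  term (suc k) _ = trans (cong (logPS (suc k) *_) (logPow-low (ℕ.≤-<-trans (ℕ.m∸n≤m n k) n<l)))
                         (ℚ.*-zeroʳ (logPS (suc k)))

logPow-+ : ∀ i j → logPow (i ℕ.+ j) ≈ logPow i ⊛ logPow j
logPow-+ zero    j n = sym (⊛-identityˡ (logPow j) n)
logPow-+ (suc i) j n = trans (⊛-congʳ logPS (logPow-+ i j) n) (⊛-assoc logPS (logPow i) (logPow j) n)

Θ-log : Θ logPS ≈ onePS
Θ-log zero    = refl
Θ-log (suc n) = begin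
  Θ logPS (suc n)
    ≡⟨ Θ-coeff logPS (suc n) ⟩
  ℕ→ℚ (suc (suc n)) * (- sgn n * (+ 1 / suc (suc n))) + ℕ→ℚ (suc n) * (sgn n * (+ 1 / suc n))
    ≡⟨ ring (ℕ→ℚ (suc (suc n))) (+ 1 / suc (suc n)) (ℕ→ℚ (suc n)) (+ 1 / suc n) (sgn n) ⟩
  sgn n * (ℕ→ℚ (suc n) * (+ 1 / suc n)) - sgn n * (ℕ→ℚ (suc (suc n)) * (+ 1 / suc (suc n)))
    ≡⟨ cong₂ (λ u v → sgn n * u - sgn n * v) (n*1/n≡1 n) (n*1/n≡1 (suc n)) ⟩
  sgn n * 1ℚ - sgn n * 1ℚ
    ≡⟨ ℚ.+-inverseʳ (sgn n * 1ℚ) ⟩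
  0ℚ ∎
  where
  ring : ∀ a b c d s → a * (- s * b) + c * (s * d) ≡ s * (c * d) - s * (a * b)
  ring = solve-∀ ℚ-ring

Θ-one : Θ onePS ≈ zeroPS
Θ-one n = trans (⊛-congʳ onePlusT (λ m → ℚ.*-zeroʳ (ℕ→ℚ (suc m))) n) (⊛-zeroʳ onePlusT n)

Θ-logPow : ∀ l → Θ (logPow (suc l)) ≈ ℕ→ℚ (suc l) · logPow l
Θ-logPow l n = begin
  Θ (logPS ⊛ logPow l) n                          ≡⟨ Θ-⊛ logPS (logPow l) n ⟩
  (Θ logPS ⊛ logPow l) n + (logPS ⊛ Θ (logPow l)) n
    ≡⟨ cong₂ _+_ (trans (⊛-congˡ (logPow l) Θ-log n) (⊛-identityˡ (logPow l) n)) (logPS⊛Θ l) ⟩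
  logPow l n + ℕ→ℚ l * logPow l n                  ≡⟨ ring (logPow l n) (ℕ→ℚ l) ⟩
  (1ℚ + ℕ→ℚ l) * logPow l n                        ≡⟨ cong (_* logPow l n) (ℕ→ℚ-suc l) ⟨
  ℕ→ℚ (suc l) * logPow l n                         ∎
  where
  ring : ∀ p c → p + c * p ≡ (1ℚ + c) * p
  ring = solve-∀ ℚ-ring
  logPS⊛Θ : ∀ l → (logPS ⊛ Θ (logPow l)) n ≡ ℕ→ℚ l * logPow l n
  logPS⊛Θ zero    = trans (⊛-congʳ logPS Θ-one n) (trans (⊛-zeroʳ logPS n) (sym (ℚ.*-zeroˡ (onePS n))))
  logPS⊛Θ (suc l) = trans (⊛-congʳ logPS (Θ-logPow l) n) (⊛-·ʳ (ℕ→ℚ (suc l)) logPS (logPow l) n)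

compLog : PS → PS
compLog c n = sumTo n (λ l → c l * logPow l n)

compLog-upTo : ∀ c {n N} → n ≤ N → compLog c n ≡ sumTo N (λ l → c l * logPow l n)
compLog-upTo c n≤N =
  sym (sumTo-extend _ n≤N (λ l n<l → trans (cong (c l *_) (logPow-low n<l)) (ℚ.*-zeroʳ (c l))))

compLog-cong : ∀ {c c′} → c ≈ c′ → compLog c ≈ compLog c′
compLog-cong c≈c′ n = sumTo-cong n (λ l → cong (_* logPow l n) (c≈c′ l))

compLog-⊖ : ∀ f g → compLog (f ⊖ g) ≈ compLog f ⊖ compLog g
compLog-⊖ f g n = trans (sumTo-cong n (λ l → ring (f l) (g l) (logPow l n))) (sumTo-- n _ _)
  where
  ring : ∀ a b p → (a - b) * p ≡ a * p - b * p
  ring = solve-∀ ℚ-ring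

compLog-· : ∀ x c → compLog (x · c) ≈ x · compLog c
compLog-· x c n =
  trans (sumTo-cong n (λ l → ℚ.*-assoc x (c l) (logPow l n))) (sym (*-distribˡ-sumTo n x _))

compLog-t : compLog tPS ≈ logPS
compLog-t zero    = ℚ.*-zeroˡ 1ℚ
compLog-t (suc m) = begin
  compLog tPS (suc m)
    ≡⟨ sumTo-sucˡ m _ ⟩
  0ℚ * logPow 0 (suc m) + sumTo m (λ k → tPS (suc k) * logPow (suc k) (suc m))
    ≡⟨ cong₂ _+_ (ℚ.*-zeroˡ (logPow 0 (suc m))) (sumTo-extend {0} {m} _ z≤n higher) ⟩
  0ℚ + 1ℚ * logPow 1 (suc m) ≡⟨ ℚ.+-identityˡ _ ⟩
  1ℚ * logPow 1 (suc m)      ≡⟨ ℚ.*-identityˡ _ ⟩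
  logPow 1 (suc m)           ≡⟨ ⊛-identityʳ logPS (suc m) ⟩
  logPS (suc m)              ∎
  where
  higher : ∀ k → 0 < k → tPS (suc k) * logPow (suc k) (suc m) ≡ 0ℚ
  higher (suc k) _ = ℚ.*-zeroˡ (logPow (suc (suc k)) (suc m))

-- The common expansion of both sides of compLog-⊛.
logPairSum : PS → PS → PS
logPairSum f g n = sumTo n (λ i → sumTo n (λ j → (f i * g j) * logPow (i ℕ.+ j) n))

compLog-⊛≈logPairSum : ∀ f g → compLog (f ⊛ g) ≈ logPairSum f g
compLog-⊛≈logPairSum f g n = begin
  compLog (f ⊛ g) n
    ≡⟨ sumTo-cong-≤ n (λ l l≤n → cong (_* logPow l n) (⊛-as-δ-sum n n l f g l≤n l≤n)) ⟩
  sumTo n (λ l → sumTo n (λ i → sumTo n (λ j → δ (i ℕ.+ j) l * (f i * g j))) * logPow l n)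
    ≡⟨ sumTo-cong n (λ l → *-distribʳ-sumTo₂ n n (logPow l n) _) ⟩
  sumTo n (λ l → sumTo n (λ i → sumTo n (λ j → (δ (i ℕ.+ j) l * (f i * g j)) * logPow l n)))
    ≡⟨ trans (sumTo-swap n n _) (sumTo-cong n (λ i → sumTo-swap n n _)) ⟩
  sumTo n (λ i → sumTo n (λ j → sumTo n (λ l → (δ (i ℕ.+ j) l * (f i * g j)) * logPow l n)))
    ≡⟨ sumTo-cong n (λ i → sumTo-cong n (λ j → contract (i ℕ.+ j) (f i * g j))) ⟩
  logPairSum f g n ∎
  where
  reassoc : ∀ d x p → (d * x) * p ≡ d * (x * p)
  reassoc = solve-∀ ℚ-ring
  contract : ∀ m x → sumTo n (λ l → (δ m l * x) * logPow l n) ≡ x * logPow m n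
  contract m x = trans
    (sumTo-cong n (λ l → trans (reassoc (δ m l) x (logPow l n)) (cong (_* (x * logPow l n)) (δ-sym m l))))
    (sumTo-δ n m (λ l → x * logPow l n) (λ n<m → trans (cong (x *_) (logPow-low n<m)) (ℚ.*-zeroʳ x)))

compLog⊛compLog≈logPairSum : ∀ f g → compLog f ⊛ compLog g ≈ logPairSum f g
compLog⊛compLog≈logPairSum f g n = begin
  (compLog f ⊛ compLog g) n
    ≡⟨ ⊛-as-δ-squareSum n (compLog f) (compLog g) ⟩
  sumTo n (λ a → sumTo n (λ b → δ (a ℕ.+ b) n * (compLog f a * compLog g b)))
    ≡⟨ sumTo-cong-≤ n (λ a a≤n → sumTo-cong-≤ n (λ b b≤n → cong (δ (a ℕ.+ b) n *_)
         (trans (cong₂ _*_ (compLog-upTo f a≤n) (compLog-upTo g b≤n)) (sumTo-*-sumTo n n _ _)))) ⟩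
  sumTo n (λ a → sumTo n (λ b → δ (a ℕ.+ b) n *
    sumTo n (λ i → sumTo n (λ j → (f i * logPow i a) * (g j * logPow j b)))))
    ≡⟨ sumTo-cong n (λ a → sumTo-cong n (λ b → *-distribˡ-sumTo₂ n n (δ (a ℕ.+ b) n) _)) ⟩
  sumTo n (λ a → sumTo n (λ b → sumTo n (λ i → sumTo n (λ j →
    δ (a ℕ.+ b) n * ((f i * logPow i a) * (g j * logPow j b))))))
    ≡⟨ sumTo-interchange₄ n _ ⟩
  sumTo n (λ i → sumTo n (λ j → sumTo n (λ b → sumTo n (λ a →
    δ (a ℕ.+ b) n * ((f i * logPow i a) * (g j * logPow j b))))))
    ≡⟨ sumTo-cong n (λ i → sumTo-cong n (λ j → trans (sumTo-swap n n _) (collect i j))) ⟩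
  logPairSum f g n ∎
  where
  ring : ∀ d a p b q → d * ((a * p) * (b * q)) ≡ (a * b) * (d * (p * q))
  ring = solve-∀ ℚ-ring
  collect : ∀ i j →
    sumTo n (λ a → sumTo n (λ b → δ (a ℕ.+ b) n * ((f i * logPow i a) * (g j * logPow j b)))) ≡
    (f i * g j) * logPow (i ℕ.+ j) n
  collect i j = begin
    sumTo n (λ a → sumTo n (λ b → δ (a ℕ.+ b) n * ((f i * logPow i a) * (g j * logPow j b))))
      ≡⟨ sumTo-cong n (λ a → sumTo-cong n (λ b →
           ring (δ (a ℕ.+ b) n) (f i) (logPow i a) (g j) (logPow j b))) ⟩
    sumTo n (λ a → sumTo n (λ b → (f i * g j) * (δ (a ℕ.+ b) n * (logPow i a * logPow j b))))
      ≡⟨ *-distribˡ-sumTo₂ n n (f i * g j) _ ⟨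
    (f i * g j) * sumTo n (λ a → sumTo n (λ b → δ (a ℕ.+ b) n * (logPow i a * logPow j b)))
      ≡⟨ cong ((f i * g j) *_) (trans (sym (⊛-as-δ-squareSum n (logPow i) (logPow j))) (sym (logPow-+ i j n))) ⟩
    (f i * g j) * logPow (i ℕ.+ j) n ∎

compLog-⊛ : ∀ f g → compLog (f ⊛ g) ≈ compLog f ⊛ compLog g
compLog-⊛ f g n = trans (compLog-⊛≈logPairSum f g n) (sym (compLog⊛compLog≈logPairSum f g n))

Θ-compLog : ∀ c → Θ (compLog c) ≈ compLog (∂ c)
Θ-compLog c n = begin
  Θ (compLog c) n
    ≡⟨ Θ-coeff (compLog c) n ⟩
  ℕ→ℚ (suc n) * compLog c (suc n) + ℕ→ℚ n * compLog c n
    ≡⟨ cong (λ s → ℕ→ℚ (suc n) * compLog c (suc n) + ℕ→ℚ n * s) (compLog-upTo c (ℕ.n≤1+n n)) ⟩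
  ℕ→ℚ (suc n) * compLog c (suc n) + ℕ→ℚ n * sumTo (suc n) (λ l → c l * logPow l n)
    ≡⟨ cong₂ _+_ (*-distribˡ-sumTo (suc n) (ℕ→ℚ (suc n)) _) (*-distribˡ-sumTo (suc n) (ℕ→ℚ n) _) ⟩
  sumTo (suc n) (λ l → ℕ→ℚ (suc n) * (c l * logPow l (suc n))) +
  sumTo (suc n) (λ l → ℕ→ℚ n * (c l * logPow l n))
    ≡⟨ sumTo-+ (suc n) _ _ ⟨
  sumTo (suc n) (λ l → ℕ→ℚ (suc n) * (c l * logPow l (suc n)) + ℕ→ℚ n * (c l * logPow l n))
    ≡⟨ sumTo-cong (suc n) (λ l → trans (ring (ℕ→ℚ (suc n)) (ℕ→ℚ n) (c l) (logPow l (suc n)) (logPow l n))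
                                       (cong (c l *_) (sym (Θ-coeff (logPow l) n)))) ⟩
  sumTo (suc n) (λ l → c l * Θ (logPow l) n)
    ≡⟨ sumTo-sucˡ n _ ⟩
  c 0 * Θ onePS n + sumTo n (λ l → c (suc l) * Θ (logPow (suc l)) n)
    ≡⟨ cong₂ _+_ (trans (cong (c 0 *_) (Θ-one n)) (ℚ.*-zeroʳ (c 0)))
                 (sumTo-cong n (λ l → trans (cong (c (suc l) *_) (Θ-logPow l n))
                                            (ring′ (c (suc l)) (ℕ→ℚ (suc l)) (logPow l n)))) ⟩
  0ℚ + compLog (∂ c) n
    ≡⟨ ℚ.+-identityˡ _ ⟩
  compLog (∂ c) n ∎
  where
  ring : ∀ a b e p q → a * (e * p) + b * (e * q) ≡ e * (a * p + b * q)
  ring = solve-∀ ℚ-ring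
  ring′ : ∀ e a p → e * (a * p) ≡ (a * e) * p
  ring′ = solve-∀ ℚ-ring

-- e^{xt} ∘ log(1 + t) = (1 + t)^x

∂-exp : ∀ x → ∂ (expPS x) ≈ x · expPS x
∂-exp x l = begin
  ℕ→ℚ (suc l) * ((x * (x ^ l)) * (invFact l * (+ 1 / suc l)))
    ≡⟨ ring (ℕ→ℚ (suc l)) x (x ^ l) (invFact l) (+ 1 / suc l) ⟩
  (x * ((x ^ l) * invFact l)) * (ℕ→ℚ (suc l) * (+ 1 / suc l))
    ≡⟨ cong ((x * ((x ^ l) * invFact l)) *_) (n*1/n≡1 l) ⟩
  (x * ((x ^ l) * invFact l)) * 1ℚ
    ≡⟨ ℚ.*-identityʳ _ ⟩
  x * expPS x l ∎
  where
  ring : ∀ n x p i r → n * ((x * p) * (i * r)) ≡ (x * (p * i)) * (n * r)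
  ring = solve-∀ ℚ-ring

Θ-binom : ∀ x → Θ (binomPS x) ≈ x · binomPS x
Θ-binom x n = begin
  Θ (binomPS x) n
    ≡⟨ Θ-coeff (binomPS x) n ⟩
  ℕ→ℚ (suc n) * ((falling x n * (x - ℕ→ℚ n)) * (invFact n * (+ 1 / suc n))) + ℕ→ℚ n * binomPS x n
    ≡⟨ cong (_+ ℕ→ℚ n * binomPS x n)
         (ring (ℕ→ℚ (suc n)) (falling x n) (x - ℕ→ℚ n) (invFact n) (+ 1 / suc n)) ⟩
  ((x - ℕ→ℚ n) * binomPS x n) * (ℕ→ℚ (suc n) * (+ 1 / suc n)) + ℕ→ℚ n * binomPS x n
    ≡⟨ cong (λ r → ((x - ℕ→ℚ n) * binomPS x n) * r + ℕ→ℚ n * binomPS x n) (n*1/n≡1 n) ⟩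
  ((x - ℕ→ℚ n) * binomPS x n) * 1ℚ + ℕ→ℚ n * binomPS x n
    ≡⟨ ring′ x (ℕ→ℚ n) (binomPS x n) ⟩
  x * binomPS x n ∎
  where
  ring : ∀ q f y i r → q * ((f * y) * (i * r)) ≡ (y * (f * i)) * (q * r)
  ring = solve-∀ ℚ-ring
  ring′ : ∀ x k b → ((x - k) * b) * 1ℚ + k * b ≡ x * b
  ring′ = solve-∀ ℚ-ring

Θ-eigen-step : ∀ x F → Θ F ≈ x · F → ∀ n → F (suc n) ≡ (+ 1 / suc n) * ((x - ℕ→ℚ n) * F n)
Θ-eigen-step x F ΘF≈xF n = begin
  F (suc n)                                   ≡⟨ ℚ.*-identityˡ (F (suc n)) ⟨
  1ℚ * F (suc n)                              ≡⟨ cong (_* F (suc n)) (1/n*n≡1 n) ⟨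
  ((+ 1 / suc n) * ℕ→ℚ (suc n)) * F (suc n)   ≡⟨ ℚ.*-assoc (+ 1 / suc n) (ℕ→ℚ (suc n)) (F (suc n)) ⟩
  (+ 1 / suc n) * ∂ F n                       ≡⟨ cong ((+ 1 / suc n) *_) (isolate (∂ F n) (ℕ→ℚ n) (F n) x
                                                   (trans (sym (Θ-coeff F n)) (ΘF≈xF n))) ⟩
  (+ 1 / suc n) * ((x - ℕ→ℚ n) * F n)         ∎
  where
  isolate : ∀ d k f x → d + k * f ≡ x * f → d ≡ (x - k) * f
  isolate d k f x eq = begin
    d                       ≡⟨ ring d k f ⟩
    (d + k * f) - k * f     ≡⟨ cong (_- k * f) eq ⟩
    x * f - k * f           ≡⟨ ring′ x k f ⟩
    (x - k) * f             ∎
    where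
    ring : ∀ d k f → d ≡ (d + k * f) - k * f
    ring = solve-∀ ℚ-ring
    ring′ : ∀ x k f → x * f - k * f ≡ (x - k) * f
    ring′ = solve-∀ ℚ-ring

Θ-eigen-unique : ∀ x F G → Θ F ≈ x · F → Θ G ≈ x · G → F 0 ≡ G 0 → F ≈ G
Θ-eigen-unique x F G ΘF ΘG F0≡G0 zero    = F0≡G0
Θ-eigen-unique x F G ΘF ΘG F0≡G0 (suc n) = begin
  F (suc n)                             ≡⟨ Θ-eigen-step x F ΘF n ⟩
  (+ 1 / suc n) * ((x - ℕ→ℚ n) * F n)   ≡⟨ cong (λ f → (+ 1 / suc n) * ((x - ℕ→ℚ n) * f))
                                             (Θ-eigen-unique x F G ΘF ΘG F0≡G0 n) ⟩
  (+ 1 / suc n) * ((x - ℕ→ℚ n) * G n)   ≡⟨ Θ-eigen-step x G ΘG n ⟨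
  G (suc n)                             ∎

compLog-exp : ∀ x → compLog (expPS x) ≈ binomPS x
compLog-exp x = Θ-eigen-unique x (compLog (expPS x)) (binomPS x) Θ-compLog-exp (Θ-binom x) refl
  where
  Θ-compLog-exp : Θ (compLog (expPS x)) ≈ x · compLog (expPS x)
  Θ-compLog-exp n = trans (Θ-compLog (expPS x) n)
    (trans (compLog-cong (∂-exp x) n) (compLog-· x (expPS x) n))

binom-1 : binomPS 1ℚ ≈ onePlusT
binom-1 zero          = refl
binom-1 (suc zero)    = refl
binom-1 (suc (suc m)) =
  trans (cong (_* invFact (suc (suc m))) (falling-1 m)) (ℚ.*-zeroˡ (invFact (suc (suc m))))
  where
  falling-1 : ∀ m → falling 1ℚ (suc (suc m)) ≡ 0ℚ
  falling-1 zero    = refl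
  falling-1 (suc m) = trans (cong (_* (1ℚ - ℕ→ℚ (suc (suc m)))) (falling-1 m))
                            (ℚ.*-zeroˡ (1ℚ - ℕ→ℚ (suc (suc m))))

falling-−1 : ∀ n → falling (- 1ℚ) n ≡ sgn n * factℚ n
falling-−1 zero    = refl
falling-−1 (suc n) = begin
  falling (- 1ℚ) n * (- 1ℚ - ℕ→ℚ n)       ≡⟨ cong (_* (- 1ℚ - ℕ→ℚ n)) (falling-−1 n) ⟩
  (sgn n * factℚ n) * (- 1ℚ - ℕ→ℚ n)      ≡⟨ ring (sgn n) (factℚ n) (ℕ→ℚ n) ⟩
  - sgn n * ((1ℚ + ℕ→ℚ n) * factℚ n)      ≡⟨ cong (λ m → - sgn n * (m * factℚ n)) (ℕ→ℚ-suc n) ⟨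
  - sgn n * (ℕ→ℚ (suc n) * factℚ n)       ≡⟨ cong (- sgn n *_) (ℕ→ℚ-* (suc n) (n !)) ⟨
  - sgn n * factℚ (suc n)                 ∎
  where
  ring : ∀ s f k → (s * f) * (- 1ℚ - k) ≡ - s * ((1ℚ + k) * f)
  ring = solve-∀ ℚ-ring

binom-−1 : binomPS (- 1ℚ) ≈ onePlusTInv
binom-−1 n = begin
  falling (- 1ℚ) n * invFact n   ≡⟨ cong (_* invFact n) (falling-−1 n) ⟩
  (sgn n * factℚ n) * invFact n  ≡⟨ ℚ.*-assoc (sgn n) (factℚ n) (invFact n) ⟩
  sgn n * (factℚ n * invFact n)  ≡⟨ cong (sgn n *_) (factℚ*invFact≡1 n) ⟩
  sgn n * 1ℚ                     ≡⟨ ℚ.*-identityʳ (sgn n) ⟩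
  sgn n                          ∎

compLog-expDiff : compLog expDiff ≈ daeheeDen
compLog-expDiff n = trans (compLog-⊖ (expPS 1ℚ) (expPS (- 1ℚ)) n)
  (cong₂ _-_ (trans (compLog-exp 1ℚ n) (binom-1 n)) (trans (compLog-exp (- 1ℚ) n) (binom-−1 n)))

compLog-bernoulliGF : compLog (psDiv tPS expDiff) ≈ psDiv logPS daeheeDen
compLog-bernoulliGF = psDiv-unique logPS daeheeDen (compLog G) refl λ n → begin
  (compLog G ⊛ daeheeDen) n         ≡⟨ ⊛-congʳ (compLog G) compLog-expDiff n ⟨
  (compLog G ⊛ compLog expDiff) n   ≡⟨ compLog-⊛ G expDiff n ⟨
  compLog (G ⊛ expDiff) n           ≡⟨ compLog-cong (psDiv-⊛ tPS expDiff refl refl) n ⟩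
  compLog tPS n                     ≡⟨ compLog-t n ⟩
  logPS n                           ∎
  where
  G = psDiv tPS expDiff

daehee2-as-compLog : ∀ x n → daehee2 x n ≡ factℚ n * compLog (psDiv tPS expDiff ⊛ expPS x) n
daehee2-as-compLog x n = cong (factℚ n *_) (sym (begin
  compLog (psDiv tPS expDiff ⊛ expPS x) n
    ≡⟨ compLog-⊛ (psDiv tPS expDiff) (expPS x) n ⟩
  (compLog (psDiv tPS expDiff) ⊛ compLog (expPS x)) n
    ≡⟨ ⊛-cong compLog-bernoulliGF (compLog-exp x) n ⟩
  (psDiv logPS daeheeDen ⊛ binomPS x) n ∎))

S1*bernoulli2 : ∀ x n l → S1 n l * bernoulli2 x l ≡ factℚ n * ((psDiv tPS expDiff ⊛ expPS x) l * logPow l n)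
S1*bernoulli2 x n l = begin
  (factℚ n * (logPow l n * invFact l)) * (factℚ l * C l)
    ≡⟨ ring (factℚ n) (logPow l n) (invFact l) (factℚ l) (C l) ⟩
  (factℚ n * (C l * logPow l n)) * (factℚ l * invFact l)
    ≡⟨ cong ((factℚ n * (C l * logPow l n)) *_) (factℚ*invFact≡1 l) ⟩
  (factℚ n * (C l * logPow l n)) * 1ℚ                    ≡⟨ ℚ.*-identityʳ _ ⟩
  factℚ n * (C l * logPow l n)                           ∎
  where
  C = psDiv tPS expDiff ⊛ expPS x
  ring : ∀ a p i f c → (a * (p * i)) * (f * c) ≡ (a * (c * p)) * (f * i)
  ring = solve-∀ ℚ-ring

daehee2≡ΣS1*bernoulli2 : ∀ x n → daehee2 x n ≡ sumTo n (λ l → S1 n l * bernoulli2 x l)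
daehee2≡ΣS1*bernoulli2 x n = begin
  daehee2 x n                                           ≡⟨ daehee2-as-compLog x n ⟩
  factℚ n * compLog C n                                 ≡⟨ *-distribˡ-sumTo n (factℚ n) _ ⟩
  sumTo n (λ l → factℚ n * (C l * logPow l n))          ≡⟨ sumTo-cong n (λ l → S1*bernoulli2 x n l) ⟨
  sumTo n (λ l → S1 n l * bernoulli2 x l)               ∎
  where
  C = psDiv tPS expDiff ⊛ expPS x

theorem5 : ((x : ℚ) (n : ℕ) → daehee2 x n ≡ sumTo n (λ l → S1 n l * bernoulli2 x l))
    × ((n : ℕ) → daehee2 0ℚ n ≡ sumTo n (λ l → S1 n l * bernoulli2 0ℚ l))
theorem5 = daehee2≡ΣS1*bernoulli2 , daehee2≡ΣS1*bernoulli2 0ℚ
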